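{- Let $G$ be a finite simple graph on $n\geq 60$ vertices with an edge-coloring $C:E(G)\to\mathbb{N}^{+}$. For a vertex $v$, let $CN(v)$ denote the set of colors $C(e)$ of the edges $e$ of $G$ incident to $v$. Suppose that $|CN(u)\cup CN(v)|\geq n-1$ for every pair of distinct vertices $u,v$ of $G$. Then $G$ contains a heterochromatic cycle of length $4$, i.e., a cycle $x_1x_2x_3x_4x_1$ in $G$ whose four edges have four pairwise distinct colors.
   Context: An edge-coloring of a graph is an arbitrary function from its edge set to the positive integers (it need not be proper). A subgraph is called heterochromatic if every two of its edges have different colors. -}

module Defs where

open import Data.Nat using (ℕ; _≤_; _≟_)
open import Data.Bool using (Bool; T; true; false; _∨_)
open import Data.Fin using (Fin)
open import Data.List using (List; length; map; filterᵇ; allFin; deduplicate; _++_)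
open import Data.Product using (_×_)
open import Relation.Binary.PropositionalEquality using (_≡_)
open import Relation.Nullary using (¬_)

record SimpleGraph (n : ℕ) : Set where
  field
    adj   : Fin n → Fin n → Bool
    sym   : ∀ u v → adj u v ≡ adj v u
    irrfl : ∀ v → adj v v ≡ false

open SimpleGraph public

Adj : ∀ {n} → SimpleGraph n → Fin n → Fin n → Set
Adj G u v = T (adj G u v)

-- An edge is an unordered pair {u,v},
-- so we represent it by a function on ordered pairs that is symmetric on
-- edges and positive on edges (values on non-edges are irrelevant).
record EdgeColoring {n : ℕ} (G : SimpleGraph n) : Set where
  field
    col      : Fin n → Fin n → ℕ
    col-sym  : ∀ u v → Adj G u v → col u v ≡ col v u
    col-pos  : ∀ u v → Adj G u v → 1 ≤ col u v

open EdgeColoring public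

CNList : ∀ {n} {G : SimpleGraph n} → EdgeColoring G → Fin n → List ℕ
CNList {n} {G} C v = map (col C v) (filterᵇ (adj G v) (allFin n))

unionSize : ∀ {n} {G : SimpleGraph n} → EdgeColoring G → Fin n → Fin n → ℕ
unionSize C u v = length (deduplicate _≟_ (CNList C u ++ CNList C v))

record HeteroC4 {n : ℕ} {G : SimpleGraph n} (C : EdgeColoring G) : Set where
  field
    x1 x2 x3 x4 : Fin n
    d12 : ¬ x1 ≡ x2
    d13 : ¬ x1 ≡ x3
    d14 : ¬ x1 ≡ x4
    d23 : ¬ x2 ≡ x3
    d24 : ¬ x2 ≡ x4
    d34 : ¬ x3 ≡ x4
    e12 : Adj G x1 x2
    e23 : Adj G x2 x3
    e34 : Adj G x3 x4
    e41 : Adj G x4 x1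
    c12≠c23 : ¬ col C x1 x2 ≡ col C x2 x3
    c12≠c34 : ¬ col C x1 x2 ≡ col C x3 x4
    c12≠c41 : ¬ col C x1 x2 ≡ col C x4 x1
    c23≠c34 : ¬ col C x2 x3 ≡ col C x3 x4
    c23≠c41 : ¬ col C x2 x3 ≡ col C x4 x1
    c34≠c41 : ¬ col C x3 x4 ≡ col C x4 x1

-- Suppose there is no heterochromatic C4.
--
-- If some vertex u has colour degree at most n − 7, let R contain one neighbour of u of
-- each colour at u, and let B be the (at least six) remaining vertices other than u.  For
-- w ∈ B, all edges from w to R whose colour is absent at u share one colour, since two
-- different such colours would close a heterochromatic C4 through u.  If an edge ww₁
-- inside B were missing, or repeated the colour of another edge from w into B, then
-- CN(u) ∪ CN(w) would be covered by one colour per vertex other than w and w₁, i.e. by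
-- n − 2 colours.  So B is a properly coloured clique, and six vertices of such a clique
-- contain a heterochromatic C4.
--
-- Otherwise every vertex misses at most six others and sees each colour at most six
-- times.  For an edge uv₁ and a neighbour v₂ of u of another colour, all but at most
-- 37 + k vertices w close a heterochromatic C4 u v₁ w v₂, where k counts the collisions
-- of v₁ and v₂: the w at which v₁w and v₂w have the same colour.  Each w is a collision
-- for at most six v₂, so double counting over the at least n − 12 choices of v₂ gives
-- one with k ≤ 22 when n ≥ 60.

module Submission where

open import Defs hiding (sym)
open import Level using (Level; 0ℓ)
open import Data.Bool using (T; if_then_else_)
open import Data.Bool.Properties using (T?)
open import Data.Empty using (⊥; ⊥-elim)
open import Data.Fin using (Fin; zero; suc)
import Data.Fin as Fin
open import Data.Fin.Induction using (<-wellFounded)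
open import Data.Fin.Properties using (_≟_; any?)
import Data.Fin.Properties as Finₚ
open import Data.List using (List; []; _∷_; _++_; length; map; filter; tabulate; allFin; deduplicate)
open import Data.List.Properties using (length-++; length-map)
open import Data.List.Membership.Propositional using (_∈_)
open import Data.List.Membership.Propositional.Properties
open import Data.List.Relation.Binary.Subset.Propositional using (_⊆_)
open import Data.List.Relation.Unary.All as All using (All; []; _∷_)
import Data.List.Relation.Unary.All.Properties as All
open import Data.List.Relation.Unary.AllPairs using ([]; _∷_)
open import Data.List.Relation.Unary.Any using (here; there)
open import Data.List.Relation.Unary.Unique.Propositional using (Unique)
import Data.List.Relation.Unary.Unique.Propositional.Properties as Unique
open import Data.List.Relation.Unary.Unique.DecPropositional.Properties using (deduplicate-!)
open import Data.Nat using (ℕ; zero; suc; _+_; _*_; _∸_; _≤_; _<_; z≤n; s≤s; s≤s⁻¹)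
import Data.Nat as ℕ
open import Data.Nat.Properties hiding (_≟_)
open import Algebra.Properties.Semiring.Sum +-*-semiring using (sum; sum-cong-≗; ∑-comm; ∑-distrib-+; *-distribˡ-sum)
open import Data.Product using (∃; _×_; _,_; proj₁; proj₂)
open import Data.Sum using (inj₁; inj₂)
open import Function using (_∘_)
open import Induction.WellFounded using (Acc; acc)
open import Relation.Binary using (tri<; tri≈; tri>)
open import Relation.Binary.Definitions using (DecidableEquality)
open import Relation.Binary.PropositionalEquality using (_≡_; _≢_; refl; sym; trans; cong; subst; module ≡-Reasoning)
open import Relation.Nullary using (¬_; Dec; yes; no; does; ¬?; _×-dec_; contradiction)
open import Relation.Nullary.Decidable using (map′; decidable-stable)
open import Relation.Unary using (Pred; Decidable; ∁; _∪_; _∩_)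
open import Relation.Unary.Properties using (_∪?_; _∩?_; ∁?)

private
  variable
    a b p q r : Level
    A : Set a
    B : Set b
    m n : ℕ

sum-mono-≤ : {f g : Fin n → ℕ} → (∀ i → f i ≤ g i) → sum f ≤ sum g
sum-mono-≤ {zero}  f≤g = z≤n
sum-mono-≤ {suc n} f≤g = +-mono-≤ (f≤g zero) (sum-mono-≤ (f≤g ∘ suc))

sum-const : ∀ n k → sum {n} (λ _ → k) ≡ n * k
sum-const zero    k = refl
sum-const (suc n) k = cong (k +_) (sum-const n k)

indicator : {A : Set a} → Dec A → ℕ
indicator a? = if does a? then 1 else 0

count : {P : Pred (Fin n) p} → Decidable P → ℕ
count P? = sum (λ x → indicator (P? x))

module _ {P : Pred (Fin n) p} (P? : Decidable P) where

  count-mono : {Q : Pred (Fin n) q} (Q? : Decidable Q) → (∀ {x} → P x → Q x) → count P? ≤ count Q?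
  count-mono Q? P⊆Q = sum-mono-≤ pointwise
    where
    pointwise : ∀ x → indicator (P? x) ≤ indicator (Q? x)
    pointwise x with P? x | Q? x
    ... | yes px | no ¬qx = ⊥-elim (¬qx (P⊆Q px))
    ... | yes _  | yes _  = ≤-refl
    ... | no _   | _      = z≤n

  count-∪ : {Q : Pred (Fin n) q} (Q? : Decidable Q) → count (P? ∪? Q?) ≤ count P? + count Q?
  count-∪ Q? = ≤-trans (sum-mono-≤ pointwise) (≤-reflexive (∑-distrib-+ (indicator ∘ P?) (indicator ∘ Q?)))
    where
    pointwise : ∀ x → indicator ((P? ∪? Q?) x) ≤ indicator (P? x) + indicator (Q? x)
    pointwise x with P? x | Q? x
    ... | yes _ | _     = s≤s z≤n
    ... | no _  | yes _ = ≤-refl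
    ... | no _  | no _  = ≤-refl

  count-partition : {Q : Pred (Fin n) q} (Q? : Decidable Q) →
                    count P? ≡ count (P? ∩? Q?) + count (P? ∩? ∁? Q?)
  count-partition Q? = trans (sum-cong-≗ pointwise) (∑-distrib-+ (indicator ∘ (P? ∩? Q?)) (indicator ∘ (P? ∩? ∁? Q?)))
    where
    pointwise : ∀ x → indicator (P? x) ≡ indicator ((P? ∩? Q?) x) + indicator ((P? ∩? ∁? Q?) x)
    pointwise x with P? x | Q? x
    ... | yes _ | yes _ = refl
    ... | yes _ | no _  = refl
    ... | no _  | _     = refl

  count-complement : count P? + count (∁? P?) ≡ n
  count-complement = begin
    count P? + count (∁? P?)                            ≡⟨ ∑-distrib-+ (indicator ∘ P?) (indicator ∘ ∁? P?) ⟨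
    sum (λ x → indicator (P? x) + indicator (∁? P? x))  ≡⟨ sum-cong-≗ pointwise ⟩
    sum {n} (λ _ → 1)                                   ≡⟨ sum-const n 1 ⟩
    n * 1                                               ≡⟨ *-identityʳ n ⟩
    n                                                   ∎
    where
    open ≡-Reasoning
    pointwise : ∀ x → indicator (P? x) + indicator (∁? P? x) ≡ 1
    pointwise x with P? x
    ... | yes _ = refl
    ... | no _  = refl

count-∪-≤ : {P : Pred (Fin n) p} (P? : Decidable P) {Q : Pred (Fin n) q} (Q? : Decidable Q) {k l : ℕ} →
            count P? ≤ k → count Q? ≤ l → count (P? ∪? Q?) ≤ k + l
count-∪-≤ P? Q? P≤k Q≤l = ≤-trans (count-∪ P? Q?) (+-mono-≤ P≤k Q≤l)

∃⇒count>0 : {P : Pred (Fin n) p} (P? : Decidable P) {x : Fin n} → P x → 0 < count P?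
∃⇒count>0 P? {zero} px with P? zero
... | yes _  = s≤s z≤n
... | no ¬px = ⊥-elim (¬px px)
∃⇒count>0 P? {suc x} px = ≤-trans (∃⇒count>0 (P? ∘ suc) px) (m≤n+m _ (indicator (P? zero)))

∀¬⇒count≡0 : {P : Pred (Fin n) p} (P? : Decidable P) → (∀ x → ¬ P x) → count P? ≡ 0
∀¬⇒count≡0 {zero}  P? ¬P = refl
∀¬⇒count≡0 {suc n} P? ¬P with P? zero
... | yes p₀ = ⊥-elim (¬P zero p₀)
... | no _   = ∀¬⇒count≡0 (P? ∘ suc) (¬P ∘ suc)

unique⇒count≤1 : {P : Pred (Fin n) p} (P? : Decidable P) → (∀ {x y} → P x → P y → x ≡ y) → count P? ≤ 1
unique⇒count≤1 {zero}  P? unique = z≤n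
unique⇒count≤1 {suc n} P? unique with P? zero
... | yes p₀ = ≤-reflexive (cong suc (∀¬⇒count≡0 (P? ∘ suc) λ x px → Finₚ.0≢1+n (unique p₀ px)))
... | no _   = unique⇒count≤1 (P? ∘ suc) λ px py → Finₚ.suc-injective (unique px py)

count-singleton≤1 : (x : Fin n) → count (_≟ x) ≤ 1
count-singleton≤1 x = unique⇒count≤1 (_≟ x) λ y≡x z≡x → trans y≡x (sym z≡x)

count>0⇒∃ : {P : Pred (Fin n) p} (P? : Decidable P) → 0 < count P? → ∃ P
count>0⇒∃ {suc n} P? pos with P? zero
... | yes p₀ = zero , p₀
... | no _   = let x , px = count>0⇒∃ (P? ∘ suc) pos in suc x , px

∃¬⇒count<n : {P : Pred (Fin n) p} (P? : Decidable P) {x : Fin n} → ¬ P x → count P? < n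
∃¬⇒count<n {n = n} P? ¬px = begin-strict
  count P?                  <⟨ m<m+n (count P?) (∃⇒count>0 (∁? P?) ¬px) ⟩
  count P? + count (∁? P?)  ≡⟨ count-complement P? ⟩
  n                         ∎
  where open ≤-Reasoning

count<n⇒∃∁ : {P : Pred (Fin n) p} (P? : Decidable P) → count P? < n → ∃ (∁ P)
count<n⇒∃∁ {n = n} P? P<n = count>0⇒∃ (∁? P?) (+-cancelˡ-< (count P?) 0 _ (begin-strict
  count P? + 0              ≡⟨ +-identityʳ (count P?) ⟩
  count P?                  <⟨ P<n ⟩
  n                         ≡⟨ count-complement P? ⟨
  count P? + count (∁? P?)  ∎))
  where open ≤-Reasoning

count<⇒∃∖ : {P : Pred (Fin n) p} (P? : Decidable P) {Q : Pred (Fin n) q} (Q? : Decidable Q) →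
            count Q? < count P? → ∃ λ x → P x × ¬ Q x
count<⇒∃∖ P? Q? Q<P = count>0⇒∃ (P? ∩? ∁? Q?) (+-cancelˡ-< (count Q?) 0 _ (begin-strict
  count Q? + 0                                  ≡⟨ +-identityʳ (count Q?) ⟩
  count Q?                                      <⟨ Q<P ⟩
  count P?                                      ≡⟨ count-partition P? Q? ⟩
  count (P? ∩? Q?) + count (P? ∩? ∁? Q?)        ≤⟨ +-monoˡ-≤ _ (count-mono (P? ∩? Q?) Q? proj₂) ⟩
  count Q? + count (P? ∩? ∁? Q?)                ∎))
  where open ≤-Reasoning

count-remove : {P : Pred (Fin n) p} (P? : Decidable P) {x : Fin n} → P x →
               count (P? ∩? ∁? (_≟ x)) < count P?
count-remove P? {x} px = begin-strict
  count (P? ∩? ∁? (_≟ x))                           <⟨ m<n+m _ (∃⇒count>0 (P? ∩? (_≟ x)) (px , refl)) ⟩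
  count (P? ∩? (_≟ x)) + count (P? ∩? ∁? (_≟ x))    ≡⟨ count-partition P? (_≟ x) ⟨
  count P?                                          ∎
  where open ≤-Reasoning

double-count : {P : Pred (Fin m) p} (P? : Decidable P) {R : Fin m → Fin n → Set r}
               (R? : ∀ x → Decidable (R x)) {k l : ℕ} →
               (∀ {x} → P x → k ≤ count (R? x)) → (∀ y → count (λ x → R? x y) ≤ l) →
               k * count P? ≤ n * l
double-count {n = n} P? R? {k} {l} many few = begin
  k * count P?                                   ≡⟨ *-distribˡ-sum k (indicator ∘ P?) ⟩
  sum (λ x → k * indicator (P? x))               ≤⟨ sum-mono-≤ pointwise ⟩
  sum (λ x → sum (λ y → indicator (R? x y)))     ≡⟨ ∑-comm (λ x y → indicator (R? x y)) ⟩
  sum (λ y → count (λ x → R? x y))               ≤⟨ sum-mono-≤ few ⟩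
  sum {n} (λ _ → l)                              ≡⟨ sum-const n l ⟩
  n * l                                          ∎
  where
  open ≤-Reasoning
  pointwise : ∀ x → k * indicator (P? x) ≤ count (R? x)
  pointwise x with P? x
  ... | yes px = ≤-trans (≤-reflexive (*-identityʳ k)) (many px)
  ... | no _   = ≤-trans (≤-reflexive (*-zeroʳ k)) z≤n

Unique⇒length-mono : {xs ys : List A} → Unique xs → xs ⊆ ys → length xs ≤ length ys
Unique⇒length-mono {xs = []} [] _ = z≤n
Unique⇒length-mono {xs = x ∷ xs} (x∉xs ∷ xs!) xs⊆ys with ∈-∃++ (xs⊆ys (here refl))
... | ys₁ , ys₂ , refl = begin
  suc (length xs)                ≤⟨ s≤s (Unique⇒length-mono xs! xs⊆ys₁ys₂) ⟩
  suc (length (ys₁ ++ ys₂))      ≡⟨ cong suc (length-++ ys₁) ⟩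
  suc (length ys₁ + length ys₂)  ≡⟨ +-suc (length ys₁) (length ys₂) ⟨
  length ys₁ + length (x ∷ ys₂)  ≡⟨ length-++ ys₁ ⟨
  length (ys₁ ++ x ∷ ys₂)        ∎
  where
  open ≤-Reasoning
  xs⊆ys₁ys₂ : xs ⊆ ys₁ ++ ys₂
  xs⊆ys₁ys₂ {y} y∈xs with ∈-++⁻ ys₁ (xs⊆ys (there y∈xs))
  ... | inj₁ y∈ys₁         = ∈-++⁺ˡ y∈ys₁
  ... | inj₂ (here refl)   = contradiction refl (All.lookup x∉xs y∈xs)
  ... | inj₂ (there y∈ys₂) = ∈-++⁺ʳ ys₁ y∈ys₂

Unique-map⁺-injectiveOn : {P : Pred A p} {f : A → B} → (∀ {x y} → P x → P y → f x ≡ f y → x ≡ y) →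
                          {xs : List A} → All P xs → Unique xs → Unique (map f xs)
Unique-map⁺-injectiveOn inj []         []           = []
Unique-map⁺-injectiveOn inj (px ∷ pxs) (x∉xs ∷ xs!) =
  All.map⁺ (All.zipWith (λ (py , x≢y) → x≢y ∘ inj px py) (pxs , x∉xs)) ∷ Unique-map⁺-injectiveOn inj pxs xs!

length-filter-tabulate : {P : Pred A p} (P? : Decidable P) (f : Fin n → A) →
                         length (filter P? (tabulate f)) ≡ count (P? ∘ f)
length-filter-tabulate {n = zero}  P? f = refl
length-filter-tabulate {n = suc n} P? f with P? (f zero)
... | yes _ = cong suc (length-filter-tabulate P? (f ∘ suc))
... | no _  = length-filter-tabulate P? (f ∘ suc)

module _ (_≟ᴬ_ : DecidableEquality A) {P : Pred (Fin n) p} (P? : Decidable P) (g : Fin n → A) where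

  private
    image : List A
    image = map g (filter P? (allFin n))

    length-image : length image ≡ count P?
    length-image = trans (length-map g (filter P? (allFin n))) (length-filter-tabulate P? (λ x → x))

  length-deduplicate≤count : {xs : List A} → (∀ {y} → y ∈ xs → ∃ λ x → P x × y ≡ g x) →
                             length (deduplicate _≟ᴬ_ xs) ≤ count P?
  length-deduplicate≤count {xs} covered = begin
    length (deduplicate _≟ᴬ_ xs)  ≤⟨ Unique⇒length-mono (deduplicate-! _≟ᴬ_ xs) dedup⊆image ⟩
    length image                 ≡⟨ length-image ⟩
    count P?                     ∎
    where
    open ≤-Reasoning
    dedup⊆image : deduplicate _≟ᴬ_ xs ⊆ image
    dedup⊆image y∈ with covered (∈-deduplicate⁻ _≟ᴬ_ xs y∈)
    ... | x , px , refl = ∈-map⁺ g (∈-filter⁺ P? (∈-allFin x) px)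

  count≤length-deduplicate : {xs : List A} → (∀ {x y} → P x → P y → g x ≡ g y → x ≡ y) →
                             (∀ {x} → P x → g x ∈ xs) → count P? ≤ length (deduplicate _≟ᴬ_ xs)
  count≤length-deduplicate {xs} inj included = begin
    count P?                     ≡⟨ length-image ⟨
    length image                 ≤⟨ Unique⇒length-mono image! image⊆dedup ⟩
    length (deduplicate _≟ᴬ_ xs)  ∎
    where
    open ≤-Reasoning
    image! : Unique image
    image! = Unique-map⁺-injectiveOn inj (All.all-filter P? (allFin n))
                                         (Unique.filter⁺ P? (Unique.allFin⁺ n))
    image⊆dedup : image ⊆ deduplicate _≟ᴬ_ xs
    image⊆dedup y∈ with ∈-map⁻ g y∈
    ... | x , x∈ , refl = ∈-deduplicate⁺ _≟ᴬ_ (included (proj₂ (∈-filter⁻ P? {xs = allFin n} x∈)))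

6n<23s : ∀ {n s} → 60 ≤ n → n ≤ s + 12 → n * 6 < 23 * s
6n<23s {n} {s} 60≤n n≤s+12 = begin-strict
  n * 6             ≤⟨ *-monoˡ-≤ 6 n≤s+12 ⟩
  (s + 12) * 6      ≡⟨ *-distribʳ-+ 6 s 12 ⟩
  s * 6 + 72        <⟨ +-monoʳ-< (s * 6) 72<17s ⟩
  s * 6 + 17 * s    ≡⟨ cong (_+ 17 * s) (*-comm s 6) ⟩
  6 * s + 17 * s    ≡⟨ *-distribʳ-+ s 6 17 ⟨
  23 * s            ∎
  where
  open ≤-Reasoning
  72<17s : 72 < 17 * s
  72<17s = ≤-trans (m≤m+n 73 743) (*-monoʳ-≤ 17 (+-cancelʳ-≤ 12 48 s (≤-trans 60≤n n≤s+12)))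

module _ {n : ℕ} {G : SimpleGraph n} (C : EdgeColoring G) where

  private
    c : Fin n → Fin n → ℕ
    c = col C

  adj? : (v : Fin n) → Decidable (Adj G v)
  adj? v x = T? (adj G v x)

  Adj-sym : ∀ {u v} → Adj G u v → Adj G v u
  Adj-sym {u} {v} = subst T (SimpleGraph.sym G u v)

  Adj⇒≢ : ∀ {u v} → Adj G u v → u ≢ v
  Adj⇒≢ {u} uu refl = subst T (irrfl G u) uu

  col-sym′ : ∀ {u v} → Adj G u v → c u v ≡ c v u
  col-sym′ {u} {v} = col-sym C u v

  degree : Fin n → ℕ
  degree v = count (adj? v)

  colourDegree : Fin n → ℕ
  colourDegree v = length (deduplicate ℕ._≟_ (CNList C v))

  ∈-CNList⁻ : ∀ {v γ} → γ ∈ CNList C v → ∃ λ x → Adj G v x × γ ≡ c v x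
  ∈-CNList⁻ {v} γ∈ with ∈-map⁻ (c v) γ∈
  ... | x , x∈ , γ≡ = x , proj₂ (∈-filter⁻ (adj? v) {xs = allFin n} x∈) , γ≡

  ∈-CNList⁺ : ∀ {v x} → Adj G v x → c v x ∈ CNList C v
  ∈-CNList⁺ {v} {x} vx = ∈-map⁺ (c v) (∈-filter⁺ (adj? v) (∈-allFin x) vx)

  colourDegree≤degree : ∀ v → colourDegree v ≤ degree v
  colourDegree≤degree v = length-deduplicate≤count ℕ._≟_ (adj? v) (c v) ∈-CNList⁻

  degree<n : ∀ v → degree v < n
  degree<n v = ∃¬⇒count<n (adj? v) λ vv → Adj⇒≢ vv refl

  ColourClass : Fin n → ℕ → Pred (Fin n) 0ℓ
  ColourClass v γ x = Adj G v x × c v x ≡ γ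

  colourClass? : ∀ v γ → Decidable (ColourClass v γ)
  colourClass? v γ = adj? v ∩? λ x → c v x ℕ.≟ γ

  OtherColours : Fin n → ℕ → Pred (Fin n) 0ℓ
  OtherColours v γ = Adj G v ∩ ∁ λ x → c v x ≡ γ

  otherColours? : ∀ v γ → Decidable (OtherColours v γ)
  otherColours? v γ = adj? v ∩? ∁? λ x → c v x ℕ.≟ γ

  degree≡colourClass+otherColours : ∀ v γ → degree v ≡ count (colourClass? v γ) + count (otherColours? v γ)
  degree≡colourClass+otherColours v γ = count-partition (adj? v) λ x → c v x ℕ.≟ γ

  colourDegree+colourClass≤1+degree : ∀ v γ → colourDegree v + count (colourClass? v γ) ≤ suc (degree v)
  colourDegree+colourClass≤1+degree v γ with any? (colourClass? v γ)
  ... | no empty = begin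
    colourDegree v + count (colourClass? v γ)  ≡⟨ cong (colourDegree v +_) (∀¬⇒count≡0 (colourClass? v γ) (λ x vx → empty (x , vx))) ⟩
    colourDegree v + 0                         ≡⟨ +-identityʳ (colourDegree v) ⟩
    colourDegree v                             ≤⟨ colourDegree≤degree v ⟩
    degree v                                   <⟨ n<1+n (degree v) ⟩
    suc (degree v)                             ∎
    where open ≤-Reasoning
  ... | yes (x₀ , vx₀ , x₀∈γ) = begin
    colourDegree v + count (colourClass? v γ)            ≤⟨ +-monoˡ-≤ _ colourDegree≤1+others ⟩
    suc (count others? + count (colourClass? v γ))       ≡⟨ cong suc (+-comm (count others?) _) ⟩
    suc (count (colourClass? v γ) + count others?)       ≡⟨ cong suc (degree≡colourClass+otherColours v γ) ⟨
    suc (degree v)                                       ∎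
    where
    open ≤-Reasoning
    others? : Decidable (OtherColours v γ)
    others? = otherColours? v γ
    covered : ∀ {δ} → δ ∈ CNList C v → ∃ λ x → (OtherColours v γ ∪ (_≡ x₀)) x × δ ≡ c v x
    covered δ∈ with ∈-CNList⁻ δ∈
    ... | x , vx , refl with c v x ℕ.≟ γ
    ...   | yes x∈γ = x₀ , inj₂ refl , trans x∈γ (sym x₀∈γ)
    ...   | no x∉γ  = x , inj₁ (vx , x∉γ) , refl
    colourDegree≤1+others : colourDegree v ≤ suc (count others?)
    colourDegree≤1+others = begin
      colourDegree v                            ≤⟨ length-deduplicate≤count ℕ._≟_ (others? ∪? (_≟ x₀)) (c v) covered ⟩
      count (others? ∪? (_≟ x₀))                ≤⟨ count-∪ others? (_≟ x₀) ⟩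
      count others? + count (_≟ x₀)             ≤⟨ +-monoʳ-≤ (count others?) (count-singleton≤1 x₀) ⟩
      count others? + 1                         ≡⟨ +-comm (count others?) 1 ⟩
      suc (count others?)                       ∎

  HeteroC4At : Fin n → Fin n → Fin n → Fin n → Set
  HeteroC4At x1 x2 x3 x4 =
    x1 ≢ x2 × x1 ≢ x3 × x1 ≢ x4 × x2 ≢ x3 × x2 ≢ x4 × x3 ≢ x4 ×
    Adj G x1 x2 × Adj G x2 x3 × Adj G x3 x4 × Adj G x4 x1 ×
    c x1 x2 ≢ c x2 x3 × c x1 x2 ≢ c x3 x4 × c x1 x2 ≢ c x4 x1 ×
    c x2 x3 ≢ c x3 x4 × c x2 x3 ≢ c x4 x1 × c x3 x4 ≢ c x4 x1

  heteroC4At? : ∀ x1 x2 x3 x4 → Dec (HeteroC4At x1 x2 x3 x4)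
  heteroC4At? x1 x2 x3 x4 =
    ¬? (x1 ≟ x2) ×-dec ¬? (x1 ≟ x3) ×-dec ¬? (x1 ≟ x4) ×-dec
    ¬? (x2 ≟ x3) ×-dec ¬? (x2 ≟ x4) ×-dec ¬? (x3 ≟ x4) ×-dec
    adj? x1 x2 ×-dec adj? x2 x3 ×-dec adj? x3 x4 ×-dec adj? x4 x1 ×-dec
    ¬? (c x1 x2 ℕ.≟ c x2 x3) ×-dec ¬? (c x1 x2 ℕ.≟ c x3 x4) ×-dec ¬? (c x1 x2 ℕ.≟ c x4 x1) ×-dec
    ¬? (c x2 x3 ℕ.≟ c x3 x4) ×-dec ¬? (c x2 x3 ℕ.≟ c x4 x1) ×-dec ¬? (c x3 x4 ℕ.≟ c x4 x1)

  heteroC4? : Dec (HeteroC4 C)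
  heteroC4? = map′ fromAt toAt (any? λ x1 → any? λ x2 → any? λ x3 → any? λ x4 → heteroC4At? x1 x2 x3 x4)
    where
    fromAt : (∃ λ x1 → ∃ λ x2 → ∃ λ x3 → ∃ λ x4 → HeteroC4At x1 x2 x3 x4) → HeteroC4 C
    fromAt (x1 , x2 , x3 , x4 , d12 , d13 , d14 , d23 , d24 , d34 , e12 , e23 , e34 , e41 , k1 , k2 , k3 , k4 , k5 , k6) =
      record { x1 = x1 ; x2 = x2 ; x3 = x3 ; x4 = x4
             ; d12 = d12 ; d13 = d13 ; d14 = d14 ; d23 = d23 ; d24 = d24 ; d34 = d34
             ; e12 = e12 ; e23 = e23 ; e34 = e34 ; e41 = e41
             ; c12≠c23 = k1 ; c12≠c34 = k2 ; c12≠c41 = k3 ; c23≠c34 = k4 ; c23≠c41 = k5 ; c34≠c41 = k6 }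
    toAt : HeteroC4 C → ∃ λ x1 → ∃ λ x2 → ∃ λ x3 → ∃ λ x4 → HeteroC4At x1 x2 x3 x4
    toAt h = x1 , x2 , x3 , x4 , d12 , d13 , d14 , d23 , d24 , d34 , e12 , e23 , e34 , e41 ,
             c12≠c23 , c12≠c34 , c12≠c41 , c23≠c34 , c23≠c41 , c34≠c41
      where open HeteroC4 h

  module ProperClique {ℓ} {B : Pred (Fin n) ℓ} (B? : Decidable B) (6≤B : 6 ≤ count B?)
           (clique : ∀ {x y} → B x → B y → x ≢ y → Adj G x y)
           (proper : ∀ {x y z} → B x → B y → B z → y ≢ x → z ≢ x → y ≢ z → c x y ≢ c x z) where

    private
      fewer : ∀ {ℓ′} {Q : Pred (Fin n) ℓ′} (Q? : Decidable Q) {k : ℕ} → count Q? ≤ k → k ≤ 5 → count Q? < count B?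
      fewer Q? Q≤k k≤5 = ≤-trans (s≤s (≤-trans Q≤k k≤5)) 6≤B

      ColourClassInB : Fin n → ℕ → Pred (Fin n) ℓ
      ColourClassInB v γ x = B x × x ≢ v × c v x ≡ γ

      colourClassInB? : ∀ v γ → Decidable (ColourClassInB v γ)
      colourClassInB? v γ x = B? x ×-dec ¬? (x ≟ v) ×-dec c v x ℕ.≟ γ

      colourClassInB≤1 : ∀ {v} γ → B v → count (colourClassInB? v γ) ≤ 1
      colourClassInB≤1 γ bv = unique⇒count≤1 (colourClassInB? _ γ) λ {x} {y} (bx , x≢v , x∈γ) (by , y≢v , y∈γ) →
        decidable-stable (x ≟ y) λ x≢y → proper bv bx by x≢v y≢v x≢y (trans x∈γ (sym y∈γ))

      Excluded : Fin n → Fin n → Fin n → Pred (Fin n) ℓ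
      Excluded p v₁ v₂ = (_≡ p) ∪ (_≡ v₁) ∪ (_≡ v₂) ∪ ColourClassInB v₁ (c p v₂) ∪ ColourClassInB v₂ (c p v₁)

      excluded? : ∀ p v₁ v₂ → Decidable (Excluded p v₁ v₂)
      excluded? p v₁ v₂ = (_≟ p) ∪? (_≟ v₁) ∪? (_≟ v₂) ∪? colourClassInB? v₁ (c p v₂) ∪? colourClassInB? v₂ (c p v₁)

      excluded<B : ∀ {p v₁ v₂} → B v₁ → B v₂ → count (excluded? p v₁ v₂) < count B?
      excluded<B {p} {v₁} {v₂} bv₁ bv₂ = fewer (excluded? p v₁ v₂) bound ≤-refl
        where
        r₁ : Decidable (ColourClassInB v₁ (c p v₂))
        r₁ = colourClassInB? v₁ (c p v₂)
        r₂ : Decidable (ColourClassInB v₂ (c p v₁))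
        r₂ = colourClassInB? v₂ (c p v₁)
        bound : count (excluded? p v₁ v₂) ≤ 1 + (1 + (1 + (1 + 1)))
        bound = count-∪-≤ (_≟ p) ((_≟ v₁) ∪? (_≟ v₂) ∪? r₁ ∪? r₂) (count-singleton≤1 p)
               (count-∪-≤ (_≟ v₁) ((_≟ v₂) ∪? r₁ ∪? r₂) (count-singleton≤1 v₁)
               (count-∪-≤ (_≟ v₂) (r₁ ∪? r₂) (count-singleton≤1 v₂)
               (count-∪-≤ r₁ r₂ (colourClassInB≤1 (c p v₂) bv₁) (colourClassInB≤1 (c p v₁) bv₂))))

    HeteroC4-through : ∀ {p v₁ v₂} → B p → B v₁ → B v₂ → v₁ ≢ p → v₂ ≢ p → v₂ ≢ v₁ → HeteroC4 C
    HeteroC4-through {p} {v₁} {v₂} bp bv₁ bv₂ v₁≢p v₂≢p v₂≢v₁ with count<⇒∃∖ B? (excluded? p v₁ v₂) (excluded<B bv₁ bv₂)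
    ... | w , bw , w∉ = record
      { x1 = p ; x2 = v₁ ; x3 = w ; x4 = v₂
      ; d12 = v₁≢p ∘ sym ; d13 = w≢p ∘ sym ; d14 = v₂≢p ∘ sym ; d23 = w≢v₁ ∘ sym ; d24 = v₂≢v₁ ∘ sym ; d34 = w≢v₂
      ; e12 = pv₁ ; e23 = v₁w ; e34 = wv₂ ; e41 = v₂p
      ; c12≠c23 = λ e → proper bv₁ bp bw (v₁≢p ∘ sym) w≢v₁ (w≢p ∘ sym) (trans (sym (col-sym′ pv₁)) e)
      ; c12≠c34 = λ e → v₂w∉α (trans (sym (col-sym′ wv₂)) (sym e))
      ; c12≠c41 = λ e → proper bp bv₁ bv₂ v₁≢p v₂≢p (v₂≢v₁ ∘ sym) (trans e (col-sym′ v₂p))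
      ; c23≠c34 = λ e → proper bw bv₁ bv₂ (w≢v₁ ∘ sym) (w≢v₂ ∘ sym) (v₂≢v₁ ∘ sym) (trans (sym (col-sym′ v₁w)) e)
      ; c23≠c41 = λ e → v₁w∉β (trans e (col-sym′ v₂p))
      ; c34≠c41 = λ e → proper bv₂ bw bp w≢v₂ (v₂≢p ∘ sym) w≢p (trans (sym (col-sym′ wv₂)) e) }
      where
      w≢p : w ≢ p
      w≢p = w∉ ∘ inj₁
      w≢v₁ : w ≢ v₁
      w≢v₁ = w∉ ∘ inj₂ ∘ inj₁
      w≢v₂ : w ≢ v₂
      w≢v₂ = w∉ ∘ inj₂ ∘ inj₂ ∘ inj₁
      pv₁ : Adj G p v₁
      pv₁ = clique bp bv₁ (v₁≢p ∘ sym)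
      v₁w : Adj G v₁ w
      v₁w = clique bv₁ bw (w≢v₁ ∘ sym)
      wv₂ : Adj G w v₂
      wv₂ = clique bw bv₂ w≢v₂
      v₂p : Adj G v₂ p
      v₂p = clique bv₂ bp v₂≢p
      v₁w∉β : c v₁ w ≢ c p v₂
      v₁w∉β e = w∉ (inj₂ (inj₂ (inj₂ (inj₁ (bw , w≢v₁ , e)))))
      v₂w∉α : c v₂ w ≢ c p v₁
      v₂w∉α e = w∉ (inj₂ (inj₂ (inj₂ (inj₂ (bw , w≢v₂ , e)))))

    HeteroC4-exists : HeteroC4 C
    HeteroC4-exists with count>0⇒∃ B? (≤-trans (s≤s z≤n) 6≤B)
    ... | p , bp with count<⇒∃∖ B? (_≟ p) (fewer (_≟ p) (count-singleton≤1 p) (s≤s z≤n))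
    ... | v₁ , bv₁ , v₁≢p with count<⇒∃∖ B? ((_≟ p) ∪? (_≟ v₁))
                                 (fewer ((_≟ p) ∪? (_≟ v₁)) (count-∪-≤ (_≟ p) (_≟ v₁) (count-singleton≤1 p) (count-singleton≤1 v₁))
                                        (s≤s (s≤s z≤n)))
    ... | v₂ , bv₂ , v₂∉ = HeteroC4-through bp bv₁ bv₂ v₁≢p (v₂∉ ∘ inj₁) (v₂∉ ∘ inj₂)

  module RichColouring (60≤n : 60 ≤ n) (rich : ∀ v → n ≤ colourDegree v + 6) where

    n≤degree+6 : ∀ v → n ≤ degree v + 6
    n≤degree+6 v = ≤-trans (rich v) (+-monoˡ-≤ 6 (colourDegree≤degree v))

    nonNeighbours≤6 : ∀ v → count (∁? (adj? v)) ≤ 6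
    nonNeighbours≤6 v = +-cancelˡ-≤ (degree v) _ _ (begin
      degree v + count (∁? (adj? v))  ≡⟨ count-complement (adj? v) ⟩
      n                               ≤⟨ n≤degree+6 v ⟩
      degree v + 6                    ∎)
      where open ≤-Reasoning

    colourClass≤6 : ∀ v γ → count (colourClass? v γ) ≤ 6
    colourClass≤6 v γ = +-cancelˡ-≤ (colourDegree v) _ _ (begin
      colourDegree v + count (colourClass? v γ)  ≤⟨ colourDegree+colourClass≤1+degree v γ ⟩
      suc (degree v)                             ≤⟨ degree<n v ⟩
      n                                          ≤⟨ rich v ⟩
      colourDegree v + 6                         ∎)
      where open ≤-Reasoning

    Collision : Fin n → Fin n → Pred (Fin n) 0ℓ
    Collision v₁ v₂ w = Adj G v₁ w × Adj G v₂ w × c v₁ w ≡ c v₂ w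

    collision? : ∀ v₁ v₂ → Decidable (Collision v₁ v₂)
    collision? v₁ v₂ w = adj? v₁ w ×-dec adj? v₂ w ×-dec c v₁ w ℕ.≟ c v₂ w

    collisionsAt≤6 : ∀ v₁ w → count (λ v₂ → collision? v₁ v₂ w) ≤ 6
    collisionsAt≤6 v₁ w = ≤-trans (count-mono (λ v₂ → collision? v₁ v₂ w) (colourClass? w (c w v₁)) sameColourAtW)
                                  (colourClass≤6 w (c w v₁))
      where
      sameColourAtW : ∀ {v₂} → Collision v₁ v₂ w → ColourClass w (c w v₁) v₂
      sameColourAtW (v₁w , v₂w , same) = Adj-sym v₂w , trans (sym (col-sym′ v₂w)) (trans (sym same) (col-sym′ v₁w))

    private
      Blocked : Fin n → Fin n → Fin n → Pred (Fin n) 0ℓ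
      Blocked u v₁ v₂ = (_≡ u) ∪ ∁ (Adj G v₁) ∪ ∁ (Adj G v₂)
                      ∪ ColourClass v₁ (c u v₁) ∪ ColourClass v₁ (c u v₂)
                      ∪ ColourClass v₂ (c u v₁) ∪ ColourClass v₂ (c u v₂) ∪ Collision v₁ v₂

      blocked? : ∀ u v₁ v₂ → Decidable (Blocked u v₁ v₂)
      blocked? u v₁ v₂ = (_≟ u) ∪? ∁? (adj? v₁) ∪? ∁? (adj? v₂)
                       ∪? colourClass? v₁ (c u v₁) ∪? colourClass? v₁ (c u v₂)
                       ∪? colourClass? v₂ (c u v₁) ∪? colourClass? v₂ (c u v₂) ∪? collision? v₁ v₂

      blocked≤59 : ∀ {u v₁ v₂} → count (collision? v₁ v₂) ≤ 22 → count (blocked? u v₁ v₂) ≤ 59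
      blocked≤59 {u} {v₁} {v₂} few =
        count-∪-≤ (_≟ u) (nonAdj₁ ∪? nonAdj₂ ∪? class₁₁ ∪? class₁₂ ∪? class₂₁ ∪? class₂₂ ∪? coll) (count-singleton≤1 u) (
        count-∪-≤ nonAdj₁ (nonAdj₂ ∪? class₁₁ ∪? class₁₂ ∪? class₂₁ ∪? class₂₂ ∪? coll) (nonNeighbours≤6 v₁) (
        count-∪-≤ nonAdj₂ (class₁₁ ∪? class₁₂ ∪? class₂₁ ∪? class₂₂ ∪? coll) (nonNeighbours≤6 v₂) (
        count-∪-≤ class₁₁ (class₁₂ ∪? class₂₁ ∪? class₂₂ ∪? coll) (colourClass≤6 v₁ _) (
        count-∪-≤ class₁₂ (class₂₁ ∪? class₂₂ ∪? coll) (colourClass≤6 v₁ _) (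
        count-∪-≤ class₂₁ (class₂₂ ∪? coll) (colourClass≤6 v₂ _) (
        count-∪-≤ class₂₂ coll (colourClass≤6 v₂ _) few))))))
        where
        nonAdj₁ : Decidable (∁ (Adj G v₁))
        nonAdj₁ = ∁? (adj? v₁)
        nonAdj₂ : Decidable (∁ (Adj G v₂))
        nonAdj₂ = ∁? (adj? v₂)
        class₁₁ : Decidable (ColourClass v₁ (c u v₁))
        class₁₁ = colourClass? v₁ (c u v₁)
        class₁₂ : Decidable (ColourClass v₁ (c u v₂))
        class₁₂ = colourClass? v₁ (c u v₂)
        class₂₁ : Decidable (ColourClass v₂ (c u v₁))
        class₂₁ = colourClass? v₂ (c u v₁)
        class₂₂ : Decidable (ColourClass v₂ (c u v₂))
        class₂₂ = colourClass? v₂ (c u v₂)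
        coll : Decidable (Collision v₁ v₂)
        coll = collision? v₁ v₂

    fewCollisions⇒HeteroC4 : ∀ {u v₁ v₂} → Adj G u v₁ → Adj G u v₂ → c u v₁ ≢ c u v₂ →
                             count (collision? v₁ v₂) ≤ 22 → HeteroC4 C
    fewCollisions⇒HeteroC4 {u} {v₁} {v₂} uv₁ uv₂ α≢β few
      with count<n⇒∃∁ (blocked? u v₁ v₂) (≤-trans (s≤s (blocked≤59 few)) 60≤n)
    ... | w , w∉ = record
      { x1 = u ; x2 = v₁ ; x3 = w ; x4 = v₂
      ; d12 = Adj⇒≢ uv₁ ; d13 = w≢u ∘ sym ; d14 = Adj⇒≢ uv₂
      ; d23 = Adj⇒≢ v₁w ; d24 = α≢β ∘ cong (c u) ; d34 = Adj⇒≢ wv₂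
      ; e12 = uv₁ ; e23 = v₁w ; e34 = wv₂ ; e41 = Adj-sym uv₂
      ; c12≠c23 = λ e → v₁w∉α (sym e)
      ; c12≠c34 = λ e → v₂w∉α (trans (col-sym′ v₂w) (sym e))
      ; c12≠c41 = λ e → α≢β (trans e (col-sym′ (Adj-sym uv₂)))
      ; c23≠c34 = λ e → noCollision (trans e (sym (col-sym′ v₂w)))
      ; c23≠c41 = λ e → v₁w∉β (trans e (col-sym′ (Adj-sym uv₂)))
      ; c34≠c41 = λ e → v₂w∉β (trans (col-sym′ v₂w) (trans e (col-sym′ (Adj-sym uv₂)))) }
      where
      w≢u : w ≢ u
      w≢u = w∉ ∘ inj₁
      v₁w : Adj G v₁ w
      v₁w = decidable-stable (adj? v₁ w) (w∉ ∘ inj₂ ∘ inj₁)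
      v₂w : Adj G v₂ w
      v₂w = decidable-stable (adj? v₂ w) (w∉ ∘ inj₂ ∘ inj₂ ∘ inj₁)
      wv₂ : Adj G w v₂
      wv₂ = Adj-sym v₂w
      v₁w∉α : c v₁ w ≢ c u v₁
      v₁w∉α e = w∉ (inj₂ (inj₂ (inj₂ (inj₁ (v₁w , e)))))
      v₁w∉β : c v₁ w ≢ c u v₂
      v₁w∉β e = w∉ (inj₂ (inj₂ (inj₂ (inj₂ (inj₁ (v₁w , e))))))
      v₂w∉α : c v₂ w ≢ c u v₁
      v₂w∉α e = w∉ (inj₂ (inj₂ (inj₂ (inj₂ (inj₂ (inj₁ (v₂w , e)))))))
      v₂w∉β : c v₂ w ≢ c u v₂
      v₂w∉β e = w∉ (inj₂ (inj₂ (inj₂ (inj₂ (inj₂ (inj₂ (inj₁ (v₂w , e))))))))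
      noCollision : c v₁ w ≢ c v₂ w
      noCollision e = w∉ (inj₂ (inj₂ (inj₂ (inj₂ (inj₂ (inj₂ (inj₂ (v₁w , v₂w , e))))))))

    HeteroC4-at : ∀ {u v₁} → Adj G u v₁ → HeteroC4 C
    HeteroC4-at {u} {v₁} uv₁ with any? (λ v₂ → otherColours? u (c u v₁) v₂ ×-dec count (collision? v₁ v₂) ≤? 22)
    ... | yes (v₂ , (uv₂ , β≢α) , few) = fewCollisions⇒HeteroC4 uv₁ uv₂ (β≢α ∘ sym) few
    ... | no ¬few = contradiction
      (double-count (otherColours? u (c u v₁)) (collision? v₁) many (collisionsAt≤6 v₁))
      (<⇒≱ (6n<23s 60≤n n≤others+12))
      where
      others : ℕ
      others = count (otherColours? u (c u v₁))
      many : ∀ {v₂} → OtherColours u (c u v₁) v₂ → 23 ≤ count (collision? v₁ v₂)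
      many {v₂} v₂∈ = ≰⇒> λ few → ¬few (v₂ , v₂∈ , few)
      n≤others+12 : n ≤ others + 12
      n≤others+12 = begin
        n                                                ≤⟨ n≤degree+6 u ⟩
        degree u + 6                                     ≡⟨ cong (_+ 6) (degree≡colourClass+otherColours u (c u v₁)) ⟩
        count (colourClass? u (c u v₁)) + others + 6     ≤⟨ +-monoˡ-≤ 6 (+-monoˡ-≤ others (colourClass≤6 u (c u v₁))) ⟩
        6 + others + 6                                   ≡⟨ cong (_+ 6) (+-comm 6 others) ⟩
        others + 6 + 6                                   ≡⟨ +-assoc others 6 6 ⟩
        others + 12                                      ∎
        where open ≤-Reasoning

    HeteroC4-exists : HeteroC4 C
    HeteroC4-exists = HeteroC4-at (proj₂ (count>0⇒∃ (adj? u) degree>0))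
      where
      u : Fin n
      u = Fin.fromℕ< (≤-trans (s≤s z≤n) 60≤n)
      degree>0 : 0 < degree u
      degree>0 = +-cancelʳ-≤ 6 1 (degree u) (≤-trans (m≤m+n 7 53) (≤-trans 60≤n (n≤degree+6 u)))

  module PoorVertex (u : Fin n) where

    EarlierSameColour : Pred (Fin n) 0ℓ
    EarlierSameColour x = ∃ λ y → y Fin.< x × Adj G u y × c u y ≡ c u x

    earlierSameColour? : Decidable EarlierSameColour
    earlierSameColour? x = any? λ y → y Finₚ.<? x ×-dec adj? u y ×-dec c u y ℕ.≟ c u x

    Rep : Pred (Fin n) 0ℓ
    Rep x = Adj G u x × ¬ EarlierSameColour x

    rep? : Decidable Rep
    rep? x = adj? u x ×-dec ¬? (earlierSameColour? x)

    Rep-injective : ∀ {x y} → Rep x → Rep y → c u x ≡ c u y → x ≡ y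
    Rep-injective {x} {y} (ux , x-first) (uy , y-first) same with Finₚ.<-cmp x y
    ... | tri< x<y _ _ = contradiction (x , x<y , ux , same) y-first
    ... | tri≈ _ x≡y _ = x≡y
    ... | tri> _ _ y<x = contradiction (y , y<x , uy , sym same) x-first

    Rep-covers : ∀ {x} → Adj G u x → ∃ λ z → Rep z × c u z ≡ c u x
    Rep-covers {x} = go (<-wellFounded x)
      where
      go : ∀ {x} → Acc Fin._<_ x → Adj G u x → ∃ λ z → Rep z × c u z ≡ c u x
      go {x} (acc earlier) ux with earlierSameColour? x
      ... | no first = x , (ux , first) , refl
      ... | yes (y , y<x , uy , same) = let z , rz , z≡y = go (earlier y<x) uy in z , rz , trans z≡y same

    count-Rep≤colourDegree : count rep? ≤ colourDegree u
    count-Rep≤colourDegree = count≤length-deduplicate ℕ._≟_ rep? (c u) Rep-injective (∈-CNList⁺ ∘ proj₁)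

    Rest : Pred (Fin n) 0ℓ
    Rest x = ¬ Rep x × x ≢ u

    rest? : Decidable Rest
    rest? = ∁? rep? ∩? ∁? (_≟ u)

    Rep≢Rest : ∀ {x y} → Rep x → Rest y → x ≢ y
    Rep≢Rest rx (¬ry , _) refl = ¬ry rx

    n≤colourDegree+1+Rest : n ≤ colourDegree u + suc (count rest?)
    n≤colourDegree+1+Rest = begin
      n                                                         ≡⟨ count-complement rep? ⟨
      count rep? + count (∁? rep?)                              ≤⟨ +-monoˡ-≤ _ count-Rep≤colourDegree ⟩
      colourDegree u + count (∁? rep?)                          ≡⟨ cong (colourDegree u +_) (count-partition (∁? rep?) (_≟ u)) ⟩
      colourDegree u + (count (∁? rep? ∩? (_≟ u)) + count rest?) ≤⟨ +-monoʳ-≤ (colourDegree u) (+-monoˡ-≤ (count rest?) atMostU) ⟩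
      colourDegree u + suc (count rest?)                        ∎
      where
      open ≤-Reasoning
      atMostU : count (∁? rep? ∩? (_≟ u)) ≤ 1
      atMostU = ≤-trans (count-mono (∁? rep? ∩? (_≟ u)) (_≟ u) proj₂) (count-singleton≤1 u)

  module NoHeteroC4 (¬c4 : ¬ HeteroC4 C) (unions : ∀ u v → u ≢ v → n ∸ 1 ≤ unionSize C u v) (u : Fin n) where

    open PoorVertex u

    AtU : Pred ℕ 0ℓ
    AtU γ = ∃ λ z → Adj G u z × c u z ≡ γ

    atU? : Decidable AtU
    atU? γ = any? λ z → adj? u z ×-dec c u z ℕ.≟ γ

    newColours-agree : ∀ {w x x′} → Rest w → Rep x → Rep x′ → Adj G w x → Adj G w x′ →
                       ¬ AtU (c w x) → ¬ AtU (c w x′) → c w x ≡ c w x′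
    newColours-agree {w} {x} {x′} rest-w rx rx′ wx wx′ new new′ with x ≟ x′
    ... | yes refl = refl
    ... | no x≢x′  = decidable-stable (c w x ℕ.≟ c w x′) λ differ → ¬c4 record
      { x1 = u ; x2 = x ; x3 = w ; x4 = x′
      ; d12 = Adj⇒≢ ux ; d13 = proj₂ rest-w ∘ sym ; d14 = Adj⇒≢ ux′
      ; d23 = Rep≢Rest rx rest-w ; d24 = x≢x′ ; d34 = Adj⇒≢ wx′
      ; e12 = ux ; e23 = Adj-sym wx ; e34 = wx′ ; e41 = Adj-sym ux′
      ; c12≠c23 = λ e → new (x , ux , trans e (sym (col-sym′ wx)))
      ; c12≠c34 = λ e → new′ (x , ux , e)
      ; c12≠c41 = λ e → x≢x′ (Rep-injective rx rx′ (trans e (col-sym′ x′u)))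
      ; c23≠c34 = λ e → differ (trans (col-sym′ wx) e)
      ; c23≠c41 = λ e → new (x′ , ux′ , sym (trans (col-sym′ wx) (trans e (col-sym′ x′u))))
      ; c34≠c41 = λ e → new′ (x′ , ux′ , sym (trans e (col-sym′ x′u))) }
      where
      ux : Adj G u x
      ux = proj₁ rx
      ux′ : Adj G u x′
      ux′ = proj₁ rx′
      x′u : Adj G x′ u
      x′u = Adj-sym ux′

    newColour : ∀ {w} → Rest w → ∃ λ φ → ∀ {x} → Rep x → Adj G w x → ¬ AtU (c w x) → c w x ≡ φ
    newColour {w} rest-w with any? (λ x → rep? x ×-dec adj? w x ×-dec ¬? (atU? (c w x)))
    ... | no none = 0 , λ {x} rx wx new → contradiction (x , rx , wx , new) none
    ... | yes (x₀ , rx₀ , wx₀ , new₀) = c w x₀ , λ rx wx new → newColours-agree rest-w rx rx₀ wx wx₀ new new₀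

    module Slot {w} (rest-w : Rest w) where

      φ : ℕ
      φ = proj₁ (newColour rest-w)

      slot : Fin n → ℕ
      slot x with x ≟ u | rep? x
      ... | yes _ | _     = φ
      ... | no _  | yes _ = c u x
      ... | no _  | no _  = c w x

      slot-u : slot u ≡ φ
      slot-u with u ≟ u
      ... | yes _   = refl
      ... | no u≢u  = contradiction refl u≢u

      slot-Rep : ∀ {x} → Rep x → slot x ≡ c u x
      slot-Rep {x} rx with x ≟ u | rep? x
      ... | yes refl | _     = contradiction refl (Adj⇒≢ (proj₁ rx))
      ... | no _     | yes _ = refl
      ... | no _     | no ¬rx = contradiction rx ¬rx

      slot-Rest : ∀ {x} → Rest x → slot x ≡ c w x
      slot-Rest {x} (¬rx , x≢u) with x ≟ u | rep? x
      ... | yes x≡u | _     = contradiction x≡u x≢u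
      ... | no _    | yes rx = contradiction rx ¬rx
      ... | no _    | no _  = refl

    -- The slots of the n − 2 vertices other than w and w₁ cover CN(u) ∪ CN(w).
    redundantEdge⇒⊥ : ∀ {w w₁} → Rest w → Rest w₁ → w₁ ≢ w →
                      (Adj G w w₁ → ∃ λ w₂ → Rest w₂ × w₂ ≢ w × w₂ ≢ w₁ × c w w₁ ≡ c w w₂) → ⊥
    redundantEdge⇒⊥ {w} {w₁} rest-w rest-w₁ w₁≢w redundant = <⇒≱ keep+1<n n≤keep+1
      where
      open Slot rest-w

      Keep : Pred (Fin n) 0ℓ
      Keep x = x ≢ w × x ≢ w₁

      keep? : Decidable Keep
      keep? = ∁? (_≟ w) ∩? ∁? (_≟ w₁)

      atRep : ∀ {z} → Rep z → ∃ λ x → Keep x × c u z ≡ slot x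
      atRep {z} rz = z , (Rep≢Rest rz rest-w , Rep≢Rest rz rest-w₁) , sym (slot-Rep rz)

      atU : ∀ {y} → Adj G u y → ∃ λ x → Keep x × c u y ≡ slot x
      atU uy = let z , rz , z≡y = Rep-covers uy ; x , kx , z≡x = atRep rz in x , kx , trans (sym z≡y) z≡x

      atW : ∀ {y} → Adj G w y → ∃ λ x → Keep x × c w y ≡ slot x
      atW {y} wy with y ≟ u | rep? y
      ... | yes refl | _ = let x , kx , e = atU (Adj-sym wy) in x , kx , trans (col-sym′ wy) e
      ... | no y≢u | yes ry with atU? (c w y)
      ...   | yes (z , uz , z≡y) = let x , kx , e = atU uz in x , kx , trans (sym z≡y) e
      ...   | no new = u , (proj₂ rest-w ∘ sym , proj₂ rest-w₁ ∘ sym) , trans (proj₂ (newColour rest-w) ry wy new) (sym slot-u)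
      atW {y} wy | no y≢u | no ¬ry with y ≟ w₁
      ... | no y≢w₁ = y , (Adj⇒≢ wy ∘ sym , y≢w₁) , sym (slot-Rest (¬ry , y≢u))
      ... | yes refl = let w₂ , rest-w₂ , w₂≢w , w₂≢w₁ , same = redundant wy
                       in w₂ , (w₂≢w , w₂≢w₁) , trans same (sym (slot-Rest rest-w₂))

      covered : ∀ {γ} → γ ∈ CNList C u ++ CNList C w → ∃ λ x → Keep x × γ ≡ slot x
      covered γ∈ with ∈-++⁻ (CNList C u) γ∈
      ... | inj₁ γ∈u with ∈-CNList⁻ γ∈u
      ...   | y , uy , refl = atU uy
      covered γ∈ | inj₂ γ∈w with ∈-CNList⁻ γ∈w
      ...   | y , wy , refl = atW wy

      n≤keep+1 : n ≤ suc (count keep?)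
      n≤keep+1 = ≤-trans (m≤n+m∸n n 1)
        (s≤s (≤-trans (unions u w (proj₂ rest-w ∘ sym)) (length-deduplicate≤count ℕ._≟_ keep? slot covered)))

      keep+1<n : suc (count keep?) < n
      keep+1<n = ≤-trans (s≤s (count-remove (∁? (_≟ w)) w₁≢w)) (∃¬⇒count<n (∁? (_≟ w)) (λ w≢w → w≢w refl))

    Rest-clique : ∀ {w w₁} → Rest w → Rest w₁ → w ≢ w₁ → Adj G w w₁
    Rest-clique rest-w rest-w₁ w≢w₁ = decidable-stable (adj? _ _) λ ¬ww₁ →
      redundantEdge⇒⊥ rest-w rest-w₁ (w≢w₁ ∘ sym) λ ww₁ → contradiction ww₁ ¬ww₁

    Rest-proper : ∀ {w w₁ w₂} → Rest w → Rest w₁ → Rest w₂ → w₁ ≢ w → w₂ ≢ w → w₁ ≢ w₂ → c w w₁ ≢ c w w₂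
    Rest-proper {w₂ = w₂} rest-w rest-w₁ rest-w₂ w₁≢w w₂≢w w₁≢w₂ same =
      redundantEdge⇒⊥ rest-w rest-w₁ w₁≢w λ _ → w₂ , rest-w₂ , w₂≢w , w₁≢w₂ ∘ sym , same

    poorVertex⇒⊥ : colourDegree u + 6 < n → ⊥
    poorVertex⇒⊥ poor = ¬c4 (ProperClique.HeteroC4-exists rest? 6≤Rest Rest-clique Rest-proper)
      where
      6≤Rest : 6 ≤ count rest?
      6≤Rest = s≤s⁻¹ (+-cancelˡ-< (colourDegree u) 6 (suc (count rest?)) (<-≤-trans poor n≤colourDegree+1+Rest))

theorem6 : (n : ℕ) → 60 ≤ n → (G : SimpleGraph n) → (C : EdgeColoring G) →
    ((u v : Fin n) → ¬ u ≡ v → n ∸ 1 ≤ unionSize C u v) →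
    HeteroC4 C
theorem6 n 60≤n G C unions = decidable-stable (heteroC4? C) ¬¬heteroC4
  where
  ¬¬heteroC4 : ¬ ¬ HeteroC4 C
  ¬¬heteroC4 ¬c4 with any? (λ u → colourDegree C u + 6 <? n)
  ... | yes (u , poor) = NoHeteroC4.poorVertex⇒⊥ C ¬c4 unions u poor
  ... | no ¬poor       = ¬c4 (RichColouring.HeteroC4-exists C 60≤n λ v → ≮⇒≥ (¬poor ∘ (v ,_)))
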